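{- A class of graphs has bounded treewidth if and only if it is distance-$\infty$ deletion-breakable.
   Context: A class $\mathcal{C}$ is distance-$\infty$ deletion-breakable if there exist a function $N:\mathbb{N}\to\mathbb{N}$ and a constant $k$ such that for all $m\in\mathbb{N}$, $G\in\mathcal{C}$ and $W\subseteq V(G)$ with $|W|\ge N(m)$ there exist a set $S\subseteq V(G)$ with $|S|\le k$ and subsets $A,B\subseteq W\setminus S$ with $|A|,|B|\ge m$ such that in $G-S$ no $a\in A$ and $b\in B$ lie in the same connected component. Treewidth is the standard graph parameter. -}

module Defs where

open import Data.Nat using (ℕ; zero; suc; _≤_; _≥_; _+_)
open import Data.Fin using (Fin; zero; suc; toℕ; inject₁)
open import Data.Fin.Properties using () renaming (_≟_ to _≟ᶠ_)
open import Data.Fin.Subset using (Subset; _∈_; _∉_; _⊆_; ∣_∣)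
open import Data.Bool using (Bool; true; false; _∨_)
open import Data.Product using (Σ; ∃; _×_; _,_)
open import Relation.Binary.PropositionalEquality using (_≡_)
open import Relation.Nullary using (¬_)
open import Relation.Nullary.Decidable using (⌊_⌋)

record Graph : Set where
  field
    n     : ℕ
    adj   : Fin n → Fin n → Bool
    sym   : ∀ u v → adj u v ≡ adj v u
    loopless : ∀ v → adj v v ≡ false
open Graph public

GraphClass : Set₁
GraphClass = Graph → Set

data Connected {m : ℕ} (P : Fin m → Set) (E : Fin m → Fin m → Bool)
       : Fin m → Fin m → Set where
  here : ∀ {x} → P x → Connected P E x x
  step : ∀ {x y z} → P x → E x y ≡ true → Connected P E y z → Connected P E x z

SameComponentIn-G-minus : (G : Graph) → Subset (n G) → Fin (n G) → Fin (n G) → Set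
SameComponentIn-G-minus G S = Connected (λ v → v ∉ S) (adj G)

-- A tree on node set Fin (suc t) is given by a parent function:
-- node (suc i) has parent par i, a node of smaller index (toℕ (par i) ≤ toℕ i).
-- Every finite nonempty tree arises this way (root it at node 0 and number
-- nodes in BFS order), and every such parent function yields a tree.

record Tree : Set where
  field
    t    : ℕ
    par  : Fin t → Fin (suc t)
    par< : ∀ i → toℕ (par i) ≤ toℕ i
open Tree public

isChildOf : (T : Tree) → Fin (suc (t T)) → Fin (suc (t T)) → Bool
isChildOf T zero    y = false
isChildOf T (suc i) y = ⌊ par T i ≟ᶠ y ⌋

treeAdj : (T : Tree) → Fin (suc (t T)) → Fin (suc (t T)) → Bool
treeAdj T x y = isChildOf T x y ∨ isChildOf T y x

record TreeDecomposition (G : Graph) : Set where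
  field
    tree : Tree
    bag  : Fin (suc (t tree)) → Subset (n G)
    covers-vertices : ∀ v → ∃ λ x → v ∈ bag x
    covers-edges    : ∀ u v → adj G u v ≡ true → ∃ λ x → (u ∈ bag x) × (v ∈ bag x)
    connected-occurrence : ∀ v x y → v ∈ bag x → v ∈ bag y →
                           Connected (λ z → v ∈ bag z) (treeAdj tree) x y
open TreeDecomposition public

HasWidthAtMost : {G : Graph} → TreeDecomposition G → ℕ → Set
HasWidthAtMost {G} D k = ∀ x → ∣ bag D x ∣ ≤ suc k

TreewidthAtMost : Graph → ℕ → Set
TreewidthAtMost G k = Σ (TreeDecomposition G) λ D → HasWidthAtMost D k

BoundedTreewidth : GraphClass → Set
BoundedTreewidth C = Σ ℕ λ k → ∀ G → C G → TreewidthAtMost G k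

DisjointFrom : {m : ℕ} → Subset m → Subset m → Set
DisjointFrom A S = ∀ v → v ∈ A → v ∉ S

DistInfDeletionBreakable : GraphClass → Set
DistInfDeletionBreakable C =
  Σ (ℕ → ℕ) λ N → Σ ℕ λ k →
    ∀ (m : ℕ) (G : Graph) → C G → (W : Subset (n G)) → ∣ W ∣ ≥ N m →
    Σ (Subset (n G)) λ S → Σ (Subset (n G)) λ A → Σ (Subset (n G)) λ B →
      (∣ S ∣ ≤ k) ×
      (A ⊆ W) × DisjointFrom A S ×
      (B ⊆ W) × DisjointFrom B S ×
      (∣ A ∣ ≥ m) × (∣ B ∣ ≥ m) ×
      (∀ a b → a ∈ A → b ∈ B → ¬ SameComponentIn-G-minus G S a b)

-- (⇒) Fix a tree decomposition of width k and call a node heavy when the bags below it meet W in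
-- at least m + k + 1 vertices.  Take a heavy node x all of whose children are light.  Adding the
-- subtrees of the children of x one at a time, each step adds fewer than m + k + 1 vertices of W,
-- so for some j the vertices of W outside bag x lying below the first j children number between m
-- and 2m + k; they form A, the other vertices of W outside bag x form B, and bag x separates them
-- because a walk leaving the subtree of a child of x must meet the bag of x.
--
-- (⇐) If every set of L = N (k + 1) vertices can be broken by at most k vertices into two sides of
-- at least k + 1 vertices, a decomposition of width L + k is built top-down.  The invariant is a set U still to
-- be decomposed whose neighbours outside U lie in the root bag W, with ∣ W ∣ ≤ L.  While ∣ W ∣ < L a
-- vertex of U is moved into W.  Once ∣ W ∣ = L, break W by S into A and B, take W ∪ S as the root and
-- recurse on both sides of S (the vertices reachable from A in G − S, and the rest), each with new
-- root bag its part of W plus S.  That root misses the at least k + 1 vertices of W on the other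
-- side and gains at most k vertices of S, so it has fewer than L vertices.
{-# OPTIONS --safe #-}
module Submission where

open import Defs
open import Data.Bool using (Bool; true; false)
open import Data.Bool.Properties using (∨-comm) renaming (_≟_ to _≟ᵇ_)
open import Data.Empty using (⊥; ⊥-elim)
open import Data.Fin using (Fin; zero; suc; toℕ; fromℕ<; _↑ˡ_; _↑ʳ_; splitAt; join)
open import Data.Fin.Properties
  using (any?; toℕ-fromℕ<; toℕ<n; toℕ-injective; toℕ-↑ˡ; toℕ-↑ʳ; toℕ≤pred[n]; splitAt-↑ˡ; splitAt-↑ʳ; join-splitAt)
  renaming (_≟_ to _≟ᶠ_)
open import Data.Fin.Subset using (Subset; _∈_; _∉_; _⊆_; _∪_; _∩_; ∣_∣; ⁅_⁆; ∁; inside; outside)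
  renaming (⊤ to full; ⊥ to ∅)
open import Data.Fin.Subset.Properties
  using (_∈?_; nonempty?; Empty-unique; ∈⊤; ∉⊥; ∣⊥∣≡0; ∣p∣≤n; ∣p∣≤∣x∷p∣; drop-∷-⊆; p⊆q⇒∣p∣≤∣q∣; p⊂q⇒∣p∣<∣q∣;
         p⊆p∪q; x∈p∪q⁺; x∈p∪q⁻; p∩q⊆p; x∈p∩q⁺; x∈p∩q⁻; x∈∁p⇒x∉p; x∉p⇒x∈∁p;
         x∈⁅x⁆; x∈⁅y⁆⇒x≡y; ∣⁅x⁆∣≡1; x∈p⇒∣p-x∣<∣p∣; x∈p∧x≢y⇒x∈p-y)
open import Data.Nat using (ℕ; zero; suc; _+_; _≤_; _<_; _≥_; z≤n; s≤s)
open import Data.Nat.Properties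
open import Data.Product using (Σ; ∃; _×_; _,_; proj₁; proj₂)
open import Data.Sum using (_⊎_; inj₁; inj₂; [_,_]′)
open import Data.Vec using ([]; _∷_; tabulate; here; there)
open import Data.Vec.Properties using (lookup∘tabulate; lookup⇒[]=; []=⇒lookup)
open import Function using (_∘_; _∘′_)
open import Function.Bundles using (_⇔_; mk⇔)
open import Level using (0ℓ)
open import Relation.Binary.PropositionalEquality as ≡ using (_≡_; _≢_; refl; cong; subst; trans)
open import Relation.Nullary using (¬_; Dec; yes; no; does)
open import Relation.Nullary.Decidable using (dec-true; _×-dec_; _⊎-dec_; ¬?)
open import Relation.Unary using (Pred; Decidable)

module _ {n ℓ} {P : Pred (Fin n) ℓ} (P? : Decidable P) where

  subset : Subset n
  subset = tabulate λ x → does (P? x)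

  ∈-subset⁺ : ∀ {x} → P x → x ∈ subset
  ∈-subset⁺ {x} px = lookup⇒[]= x subset (trans (lookup∘tabulate _ x) (dec-true (P? x) px))

  ∈-subset⁻ : ∀ {x} → x ∈ subset → P x
  ∈-subset⁻ {x} x∈ with P? x | trans (≡.sym (lookup∘tabulate _ x)) ([]=⇒lookup x∈)
  ... | yes px | _ = px
  ... | no _   | ()

∣p∪q∣≤∣p∣+∣q∣ : ∀ {n} (p q : Subset n) → ∣ p ∪ q ∣ ≤ ∣ p ∣ + ∣ q ∣
∣p∪q∣≤∣p∣+∣q∣ []            []            = z≤n
∣p∪q∣≤∣p∣+∣q∣ (inside  ∷ p) (inside  ∷ q) = s≤s (≤-trans (∣p∪q∣≤∣p∣+∣q∣ p q) (+-monoʳ-≤ ∣ p ∣ (n≤1+n ∣ q ∣)))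
∣p∪q∣≤∣p∣+∣q∣ (inside  ∷ p) (outside ∷ q) = s≤s (∣p∪q∣≤∣p∣+∣q∣ p q)
∣p∪q∣≤∣p∣+∣q∣ (outside ∷ p) (inside  ∷ q) = ≤-trans (s≤s (∣p∪q∣≤∣p∣+∣q∣ p q)) (≤-reflexive (≡.sym (+-suc ∣ p ∣ ∣ q ∣)))
∣p∪q∣≤∣p∣+∣q∣ (outside ∷ p) (outside ∷ q) = ∣p∪q∣≤∣p∣+∣q∣ p q

∣r∣≤∣p∣+∣q∣ : ∀ {n} {r : Subset n} (p q : Subset n) → (∀ {x} → x ∈ r → x ∈ p ⊎ x ∈ q) → ∣ r ∣ ≤ ∣ p ∣ + ∣ q ∣
∣r∣≤∣p∣+∣q∣ p q r⊆p∪q = ≤-trans (p⊆q⇒∣p∣≤∣q∣ (x∈p∪q⁺ ∘′ r⊆p∪q)) (∣p∪q∣≤∣p∣+∣q∣ p q)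

∣p∣+∣q∣≤∣r∣ : ∀ {n} (p q r : Subset n) → p ⊆ r → q ⊆ r → DisjointFrom p q → ∣ p ∣ + ∣ q ∣ ≤ ∣ r ∣
∣p∣+∣q∣≤∣r∣ []      []      []      _   _   _ = z≤n
∣p∣+∣q∣≤∣r∣ (x ∷ p) (y ∷ q) (z ∷ r) p⊆r q⊆r p∩q≡∅ = heads x y z p⊆r q⊆r (p∩q≡∅ zero)
  where
  tails : ∣ p ∣ + ∣ q ∣ ≤ ∣ r ∣
  tails = ∣p∣+∣q∣≤∣r∣ p q r (drop-∷-⊆ p⊆r) (drop-∷-⊆ q⊆r) (λ v v∈p v∈q → p∩q≡∅ (suc v) (there v∈p) (there v∈q))
  heads : ∀ x y z → x ∷ p ⊆ z ∷ r → y ∷ q ⊆ z ∷ r → (zero ∈ x ∷ p → zero ∉ y ∷ q) → ∣ x ∷ p ∣ + ∣ y ∷ q ∣ ≤ ∣ z ∷ r ∣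
  heads outside outside z       _   _   _ = ≤-trans tails (∣p∣≤∣x∷p∣ z r)
  heads inside  outside inside  _   _   _ = s≤s tails
  heads outside inside  inside  _   _   _ = ≤-trans (≤-reflexive (+-suc ∣ p ∣ ∣ q ∣)) (s≤s tails)
  heads inside  inside  _       _   _   d = ⊥-elim (d here here)
  heads inside  outside outside p⊆r _   _ with () ← p⊆r here
  heads outside inside  outside _   q⊆r _ with () ← q⊆r here

greatest : ∀ {t} {Q : Pred (Fin (suc t)) 0ℓ} → Decidable Q → Q zero →
           ∃ λ x → Q x × (∀ y → toℕ x < toℕ y → ¬ Q y)
greatest {t} {Q} Q? q₀ = search (suc t) ≤-refl (λ y t<y → ⊥-elim (<⇒≱ (toℕ<n y) t<y))
  where
  search : ∀ j → j ≤ suc t → (∀ y → j ≤ toℕ y → ¬ Q y) → ∃ λ x → Q x × (∀ y → toℕ x < toℕ y → ¬ Q y)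
  search zero    _   none-from-j = ⊥-elim (none-from-j zero z≤n q₀)
  search (suc j) j<n none-from-1+j with Q? (fromℕ< j<n)
  ... | yes q = fromℕ< j<n , q , λ y x<y → none-from-1+j y (subst (_< toℕ y) (toℕ-fromℕ< j<n) x<y)
  ... | no ¬q = search j (<⇒≤ j<n) none-from-j
    where
    none-from-j : ∀ y → j ≤ toℕ y → ¬ Q y
    none-from-j y j≤y with m≤n⇒m<n∨m≡n j≤y
    ... | inj₁ j<y = none-from-1+j y j<y
    ... | inj₂ j≡y = subst (λ z → ¬ Q z) (toℕ-injective (trans (toℕ-fromℕ< j<n) j≡y)) ¬q

enters-window : (f : ℕ → ℕ) {m w : ℕ} → f 0 < m + w → (∀ j → f (suc j) < f j + w) →
                ∀ top → m ≤ f top → ∃ λ j → m ≤ f j × f j < m + w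
enters-window f f₀< small-steps zero    m≤f = zero , m≤f , f₀<
enters-window f {m} {w} f₀< small-steps (suc top) m≤f with m ≤? f top
... | yes m≤f′ = enters-window f f₀< small-steps top m≤f′
... | no  m≰f′ = suc top , m≤f , <-trans (small-steps top) (+-monoˡ-< w (≰⇒> m≰f′))

module _ {m : ℕ} {P : Fin m → Set} {E : Fin m → Fin m → Bool} where

  connected-trans : ∀ {x y z} → Connected P E x y → Connected P E y z → Connected P E x z
  connected-trans (here _)        q = q
  connected-trans (step px e p) q = step px e (connected-trans p q)

  connected-source : ∀ {x y} → Connected P E x y → P x
  connected-source (here px)     = px
  connected-source (step px _ _) = px

  connected-target : ∀ {x y} → Connected P E x y → P y
  connected-target (here py)    = py
  connected-target (step _ _ p) = connected-target p

  connected-extend : ∀ {x y z} → Connected P E x y → E y z ≡ true → P z → Connected P E x z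
  connected-extend p e pz = connected-trans p (step (connected-target p) e (here pz))

connected-map : ∀ {m m′} {P : Fin m → Set} {E} {P′ : Fin m′ → Set} {E′} (f : Fin m → Fin m′) →
                (∀ x → P x → P′ (f x)) → (∀ x y → E x y ≡ true → E′ (f x) (f y) ≡ true) →
                ∀ {x y} → Connected P E x y → Connected P′ E′ (f x) (f y)
connected-map f pres-P pres-E (here px)     = here (pres-P _ px)
connected-map f pres-P pres-E (step px e p) = step (pres-P _ px) (pres-E _ _ e) (connected-map f pres-P pres-E p)

Node : Tree → Set
Node T = Fin (suc (t T))

data IsChild (T : Tree) : Node T → Node T → Set where
  child : ∀ i → IsChild T (suc i) (par T i)

module _ (T : Tree) where

  treeAdj-sym : ∀ x y → treeAdj T x y ≡ treeAdj T y x
  treeAdj-sym x y = ∨-comm (isChildOf T x y) (isChildOf T y x)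

  treeAdj-child : ∀ i {y} → par T i ≡ y → treeAdj T (suc i) y ≡ true
  treeAdj-child i {y} eq with par T i ≟ᶠ y
  ... | yes _   = refl
  ... | no  neq = ⊥-elim (neq eq)

  treeAdj-parent : ∀ i {y} → par T i ≡ y → treeAdj T y (suc i) ≡ true
  treeAdj-parent i {y} eq = trans (treeAdj-sym y (suc i)) (treeAdj-child i eq)

  isChildOf⇒IsChild : ∀ x y → isChildOf T x y ≡ true → IsChild T x y
  isChildOf⇒IsChild (suc i) y h with par T i ≟ᶠ y
  isChildOf⇒IsChild (suc i) y h  | yes refl = child i
  isChildOf⇒IsChild (suc i) y () | no _

  treeAdj⇒IsChild : ∀ x y → treeAdj T x y ≡ true → IsChild T x y ⊎ IsChild T y x
  treeAdj⇒IsChild x y h with isChildOf T x y in x◁y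
  ... | true  = inj₁ (isChildOf⇒IsChild x y x◁y)
  ... | false = inj₂ (isChildOf⇒IsChild y x h)

singletonTree : Tree
singletonTree = record { t = 0 ; par = λ () ; par< = λ () }

module Graft (T₁ : Tree) (p : Node T₁) (T₂ : Tree) where

  private
    t₁ = t T₁
    t₂ = t T₂

  left : Node T₁ → Fin (suc t₁ + suc t₂)
  left x = x ↑ˡ suc t₂

  right : Node T₂ → Fin (suc t₁ + suc t₂)
  right y = suc t₁ ↑ʳ y

  -- non-root node suc i is split as a non-root node of T₁ or a node of T₂; the root of T₂ hangs below p
  parent : Fin t₁ ⊎ Node T₂ → Fin (suc t₁ + suc t₂)
  parent (inj₁ i)       = left (par T₁ i)
  parent (inj₂ zero)    = left p
  parent (inj₂ (suc j)) = right (par T₂ j)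

  parent≤ : ∀ s → toℕ (parent s) ≤ toℕ (join t₁ (suc t₂) s)
  parent≤ (inj₁ i) rewrite toℕ-↑ˡ (par T₁ i) (suc t₂) | toℕ-↑ˡ i (suc t₂) = par< T₁ i
  parent≤ (inj₂ zero) rewrite toℕ-↑ˡ p (suc t₂) | toℕ-↑ʳ t₁ (zero {t₂}) | +-identityʳ t₁ = toℕ≤pred[n] p
  parent≤ (inj₂ (suc j)) rewrite toℕ-↑ʳ (suc t₁) (par T₂ j) | toℕ-↑ʳ t₁ (suc j) | +-suc t₁ (toℕ j) =
    s≤s (+-monoʳ-≤ t₁ (par< T₂ j))

  grafted : Tree
  grafted = record
    { t    = t₁ + suc t₂
    ; par  = parent ∘′ splitAt t₁
    ; par< = λ i → subst (toℕ (parent (splitAt t₁ i)) ≤_) (cong toℕ (join-splitAt t₁ (suc t₂) i))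
                         (parent≤ (splitAt t₁ i))
    }

  data View : Node grafted → Set where
    inLeft  : ∀ x → View (left x)
    inRight : ∀ y → View (right y)

  view : ∀ z → View z
  view z = subst View (join-splitAt (suc t₁) (suc t₂) z) (view′ (splitAt (suc t₁) z))
    where
    view′ : ∀ s → View (join (suc t₁) (suc t₂) s)
    view′ (inj₁ x) = inLeft x
    view′ (inj₂ y) = inRight y

  left-adj : ∀ x y → treeAdj T₁ x y ≡ true → treeAdj grafted (left x) (left y) ≡ true
  left-adj x y h with treeAdj⇒IsChild T₁ x y h
  ... | inj₁ (child i) = treeAdj-child grafted (i ↑ˡ suc t₂) (cong parent (splitAt-↑ˡ t₁ i (suc t₂)))
  ... | inj₂ (child i) = treeAdj-parent grafted (i ↑ˡ suc t₂) (cong parent (splitAt-↑ˡ t₁ i (suc t₂)))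

  right-adj : ∀ x y → treeAdj T₂ x y ≡ true → treeAdj grafted (right x) (right y) ≡ true
  right-adj x y h with treeAdj⇒IsChild T₂ x y h
  ... | inj₁ (child j) = treeAdj-child grafted (t₁ ↑ʳ suc j) (cong parent (splitAt-↑ʳ t₁ (suc t₂) (suc j)))
  ... | inj₂ (child j) = treeAdj-parent grafted (t₁ ↑ʳ suc j) (cong parent (splitAt-↑ʳ t₁ (suc t₂) (suc j)))

  glue-adj : treeAdj grafted (left p) (right zero) ≡ true
  glue-adj = treeAdj-parent grafted (t₁ ↑ʳ zero) (cong parent (splitAt-↑ʳ t₁ (suc t₂) zero))

module _ (T : Tree) where

  parent-induction : (Q : Node T → Set) → Q zero → (∀ i → Q (par T i) → Q (suc i)) → ∀ y → Q y
  parent-induction Q q₀ qₛ y = go (suc (toℕ y)) y ≤-refl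
    where
    go : ∀ fuel y → toℕ y < fuel → Q y
    go (suc fuel) zero    _  = q₀
    go (suc fuel) (suc i) lt = qₛ i (go fuel (par T i) (≤-trans (s≤s (par< T i)) (≤-pred lt)))

  data Descendant (c : Node T) : Node T → Set where
    self  : Descendant c c
    below : ∀ {i} → Descendant c (par T i) → Descendant c (suc i)

  root-ancestor : ∀ y → Descendant zero y
  root-ancestor = parent-induction (Descendant zero) self (λ _ → below)

  descendant? : ∀ c y → Dec (Descendant c y)
  descendant? c = parent-induction (λ y → Dec (Descendant c y)) at-root at-child
    where
    at-root : Dec (Descendant c zero)
    at-root with c ≟ᶠ zero
    ... | yes refl = yes self
    ... | no  c≢0  = no λ { self → c≢0 refl }
    at-child : ∀ i → Dec (Descendant c (par T i)) → Dec (Descendant c (suc i))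
    at-child i _     with c ≟ᶠ suc i
    at-child i _         | yes refl = yes self
    at-child i (yes d)   | no _     = yes (below d)
    at-child i (no ¬d)   | no c≢y   = no λ { self → c≢y refl ; (below d) → ¬d d }

  isChild? : ∀ c p → Dec (IsChild T c p)
  isChild? zero    p = no λ ()
  isChild? (suc i) p with par T i ≟ᶠ p
  ... | yes refl = yes (child i)
  ... | no  ≢p   = no λ { (child .i) → ≢p refl }

  child-index : ∀ {c p} → IsChild T c p → toℕ p < toℕ c
  child-index (child i) = s≤s (par< T i)

  descends-via-child : ∀ {x y} → Descendant x y → y ≢ x → ∃ λ c → IsChild T c x × Descendant c y
  descends-via-child self              y≢x = ⊥-elim (y≢x refl)
  descends-via-child {x} (below {i} d) y≢x with par T i ≟ᶠ x
  ... | yes refl = suc i , child i , self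
  ... | no  ≢x   = let c , c◁x , c≼ = descends-via-child d ≢x in c , c◁x , below c≼

  exit-through-parent : ∀ {P : Node T → Set} {c p y₁ y₂} → IsChild T c p → Connected P (treeAdj T) y₁ y₂ →
                        Descendant c y₁ → ¬ Descendant c y₂ → P p
  exit-through-parent c◁p (here _) d ¬d = ⊥-elim (¬d d)
  exit-through-parent {c = c} c◁p (step {y} {z} _ e walk) d ¬d with descendant? c z
  ... | yes dz = exit-through-parent c◁p walk dz ¬d
  ... | no ¬dz with treeAdj⇒IsChild T y z e | c◁p | d
  ...   | inj₂ (child j) | _        | _       = ⊥-elim (¬dz (below d))
  ...   | inj₁ (child j) | child .j | self    = connected-source walk
  ...   | inj₁ (child j) | _        | below d′ = ⊥-elim (¬dz d′)

record BagTree (m : ℕ) : Set where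
  field
    shape : Tree
    bagOf : Node shape → Subset m
    occurrences-connected : ∀ v x y → v ∈ bagOf x → v ∈ bagOf y →
                            Connected (λ z → v ∈ bagOf z) (treeAdj shape) x y
open BagTree

singletonBagTree : ∀ {m} → Subset m → BagTree m
singletonBagTree b = record
  { shape                 = singletonTree
  ; bagOf                 = λ _ → b
  ; occurrences-connected = λ { v zero zero v∈b _ → here v∈b }
  }

module GraftBags {m : ℕ} (D₁ : BagTree m) (p : Node (shape D₁)) (D₂ : BagTree m) where

  open Graft (shape D₁) p (shape D₂) public

  private
    t₁ = t (shape D₁)
    t₂ = t (shape D₂)

  bags : Node grafted → Subset m
  bags = [ bagOf D₁ , bagOf D₂ ]′ ∘′ splitAt (suc t₁)

  bags-left : ∀ x → bags (left x) ≡ bagOf D₁ x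
  bags-left x = cong [ bagOf D₁ , bagOf D₂ ]′ (splitAt-↑ˡ (suc t₁) x (suc t₂))

  bags-right : ∀ y → bags (right y) ≡ bagOf D₂ y
  bags-right y = cong [ bagOf D₁ , bagOf D₂ ]′ (splitAt-↑ʳ (suc t₁) (suc t₂) y)

  all-bags : (Q : Subset m → Set) → (∀ x → Q (bagOf D₁ x)) → (∀ y → Q (bagOf D₂ y)) → ∀ z → Q (bags z)
  all-bags Q Q₁ Q₂ z with view z
  ... | inLeft x  = subst Q (≡.sym (bags-left x)) (Q₁ x)
  ... | inRight y = subst Q (≡.sym (bags-right y)) (Q₂ y)

  Glue : Set
  Glue = ∀ v x y → v ∈ bagOf D₁ x → v ∈ bagOf D₂ y → v ∈ bagOf D₁ p × v ∈ bagOf D₂ zero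

  module _ (glue : Glue) (v : Fin m) where

    private
      Occ : Node grafted → Set
      Occ z = v ∈ bags z

      from-left : ∀ {x} → Occ (left x) → v ∈ bagOf D₁ x
      from-left {x} = subst (v ∈_) (bags-left x)

      from-right : ∀ {y} → Occ (right y) → v ∈ bagOf D₂ y
      from-right {y} = subst (v ∈_) (bags-right y)

      walk₁ : ∀ x y → v ∈ bagOf D₁ x → v ∈ bagOf D₁ y → Connected Occ (treeAdj grafted) (left x) (left y)
      walk₁ x y v∈x v∈y = connected-map left (λ x → subst (v ∈_) (≡.sym (bags-left x))) left-adj
                                        (occurrences-connected D₁ v x y v∈x v∈y)

      walk₂ : ∀ x y → v ∈ bagOf D₂ x → v ∈ bagOf D₂ y → Connected Occ (treeAdj grafted) (right x) (right y)
      walk₂ x y v∈x v∈y = connected-map right (λ y → subst (v ∈_) (≡.sym (bags-right y))) right-adj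
                                        (occurrences-connected D₂ v x y v∈x v∈y)

      walk : ∀ {x y} → View x → View y → Occ x → Occ y → Connected Occ (treeAdj grafted) x y
      walk (inLeft a)  (inLeft b)  v∈a v∈b = walk₁ a b (from-left v∈a) (from-left v∈b)
      walk (inRight a) (inRight b) v∈a v∈b = walk₂ a b (from-right v∈a) (from-right v∈b)
      walk (inLeft a)  (inRight b) v∈a v∈b =
        let v∈p , v∈root = glue v a b (from-left v∈a) (from-right v∈b)
            to-p = walk₁ a p (from-left v∈a) v∈p
        in connected-trans to-p (step (connected-target to-p) glue-adj (walk₂ zero b v∈root (from-right v∈b)))
      walk (inRight a) (inLeft b)  v∈a v∈b =
        let v∈p , v∈root = glue v b a (from-left v∈b) (from-right v∈a)
            to-root = walk₂ a zero (from-right v∈a) v∈root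
            adj     = trans (treeAdj-sym grafted (right zero) (left p)) glue-adj
        in connected-trans to-root (step (connected-target to-root) adj (walk₁ p b v∈p (from-left v∈b)))

    graft-connected : ∀ x y → Occ x → Occ y → Connected Occ (treeAdj grafted) x y
    graft-connected x y = walk (view x) (view y)

  graft : Glue → BagTree m
  graft glue = record
    { shape                 = grafted
    ; bagOf                 = bags
    ; occurrences-connected = graft-connected glue
    }

module Closure {m} (E : Fin m → Fin m → Bool) {P : Pred (Fin m) 0ℓ} (P? : Decidable P)
               (A : Subset m) (A⊆P : ∀ {a} → a ∈ A → P a) where

  ReachableFromA : Fin m → Set
  ReachableFromA v = ∃ λ a → a ∈ A × Connected P E a v

  Closed : Subset m → Set
  Closed X = ∀ {u v} → u ∈ X → P v → E u v ≡ true → v ∈ X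

  record ClosedHull : Set where
    field
      hull      : Subset m
      ⊇A        : A ⊆ hull
      reachable : ∀ {v} → v ∈ hull → ReachableFromA v
      closed    : Closed hull

  Exit : Subset m → Fin m → Set
  Exit R v = v ∉ R × P v × ∃ λ u → u ∈ R × E u v ≡ true

  exit? : ∀ R → Dec (∃ (Exit R))
  exit? R = any? λ v → ¬? (v ∈? R) ×-dec P? v ×-dec any? (λ u → u ∈? R ×-dec E u v ≟ᵇ true)

  no-exit⇒closed : ∀ {R} → ¬ ∃ (Exit R) → Closed R
  no-exit⇒closed {R} no-exit {u} {v} u∈R pv e with v ∈? R
  ... | yes v∈R = v∈R
  ... | no  v∉R = ⊥-elim (no-exit (v , v∉R , pv , u , u∈R , e))

  grow : ∀ fuel R → m ≤ fuel + ∣ R ∣ → A ⊆ R → (∀ {v} → v ∈ R → ReachableFromA v) → ClosedHull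
  grow fuel R bound A⊆R reach with exit? R
  ... | no no-exit = record { hull = R ; ⊇A = A⊆R ; reachable = reach ; closed = no-exit⇒closed no-exit }
  ... | yes (v , v∉R , pv , u , u∈R , e) = continue fuel bound
    where
    R′ : Subset m
    R′ = R ∪ ⁅ v ⁆

    ∣R∣<∣R′∣ : ∣ R ∣ < ∣ R′ ∣
    ∣R∣<∣R′∣ = p⊂q⇒∣p∣<∣q∣ (p⊆p∪q ⁅ v ⁆ , v , x∈p∪q⁺ (inj₂ (x∈⁅x⁆ v)) , v∉R)

    reach′ : ∀ {w} → w ∈ R′ → ReachableFromA w
    reach′ {w} w∈R′ with x∈p∪q⁻ R ⁅ v ⁆ w∈R′
    ... | inj₁ w∈R = reach w∈R
    ... | inj₂ w∈⁅v⁆ rewrite x∈⁅y⁆⇒x≡y v w∈⁅v⁆ =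
      let a , a∈A , a⇝u = reach u∈R in a , a∈A , connected-extend a⇝u e pv

    continue : ∀ fuel → m ≤ fuel + ∣ R ∣ → ClosedHull
    continue zero       bound = ⊥-elim (<⇒≱ ∣R∣<∣R′∣ (≤-trans (∣p∣≤n R′) bound))
    continue (suc fuel) bound = grow fuel R′ (≤-trans bound (≤-trans (≤-reflexive (≡.sym (+-suc fuel ∣ R ∣)))
                                                                     (+-monoʳ-≤ fuel ∣R∣<∣R′∣)))
                                     (λ a∈A → p⊆p∪q ⁅ v ⁆ (A⊆R a∈A)) reach′

  closedHull : ClosedHull
  closedHull = grow m A (m≤m+n m ∣ A ∣) (λ a∈A → a∈A) (λ {a} a∈A → a , a∈A , here (A⊆P a∈A))


Breaks : (G : Graph) → ℕ → ℕ → Subset (n G) → Set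
Breaks G k m W =
  Σ (Subset (n G)) λ S → Σ (Subset (n G)) λ A → Σ (Subset (n G)) λ B →
    (∣ S ∣ ≤ k) ×
    (A ⊆ W) × DisjointFrom A S ×
    (B ⊆ W) × DisjointFrom B S ×
    (∣ A ∣ ≥ m) × (∣ B ∣ ≥ m) ×
    (∀ a b → a ∈ A → b ∈ B → ¬ SameComponentIn-G-minus G S a b)

record Breaking (G : Graph) (k m : ℕ) (W : Subset (n G)) : Set where
  field
    S A B     : Subset (n G)
    ∣S∣≤k     : ∣ S ∣ ≤ k
    A⊆W       : A ⊆ W
    A∩S≡∅     : DisjointFrom A S
    B⊆W       : B ⊆ W
    B∩S≡∅     : DisjointFrom B S
    ∣A∣≥m     : ∣ A ∣ ≥ m
    ∣B∣≥m     : ∣ B ∣ ≥ m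
    separated : ∀ a b → a ∈ A → b ∈ B → ¬ SameComponentIn-G-minus G S a b

breaking : ∀ {G k m W} → Breaks G k m W → Breaking G k m W
breaking (S , A , B , ∣S∣≤k , A⊆W , A∩S≡∅ , B⊆W , B∩S≡∅ , ∣A∣≥m , ∣B∣≥m , separated) =
  record { S = S ; A = A ; B = B ; ∣S∣≤k = ∣S∣≤k ; A⊆W = A⊆W ; A∩S≡∅ = A∩S≡∅ ; B⊆W = B⊆W ; B∩S≡∅ = B∩S≡∅
         ; ∣A∣≥m = ∣A∣≥m ; ∣B∣≥m = ∣B∣≥m ; separated = separated }

module FromBreakability (G : Graph) (L k : ℕ) (breaks : ∀ W → ∣ W ∣ ≥ L → Breaks G k (suc k) W) where

  private
    V = Fin (n G)

  adj-sym : ∀ {u v} → adj G u v ≡ true → adj G v u ≡ true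
  adj-sym {u} {v} e = trans (Graph.sym G v u) e

  no-loop : ∀ {u} → adj G u u ≡ true → ⊥
  no-loop {u} e with () ← trans (≡.sym e) (loopless G u)

  record Frontier (U W : Subset (n G)) : Set where
    field
      disjoint       : DisjointFrom U W
      neighbours⊆U∪W : ∀ {u v} → u ∈ U → adj G u v ≡ true → v ∈ U ⊎ v ∈ W
      small          : ∣ W ∣ ≤ L

  record PartialDecomposition (U W : Subset (n G)) : Set where
    field
      bagTree      : BagTree (n G)
      bags⊆U∪W     : ∀ x {v} → v ∈ bagOf bagTree x → v ∈ U ⊎ v ∈ W
      W⊆root       : W ⊆ bagOf bagTree zero
      covers-U     : ∀ {v} → v ∈ U → ∃ λ x → v ∈ bagOf bagTree x
      covers-edges : ∀ {u v} → u ∈ U → adj G u v ≡ true → ∃ λ x → u ∈ bagOf bagTree x × v ∈ bagOf bagTree x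
      narrow       : ∀ x → ∣ bagOf bagTree x ∣ ≤ suc (L + k)
  open PartialDecomposition

  single-bag : ∀ {U W} → (∀ {v} → v ∉ U) → ∣ W ∣ ≤ L → PartialDecomposition U W
  single-bag {W = W} U≡∅ ∣W∣≤L = record
    { bagTree      = singletonBagTree W
    ; bags⊆U∪W     = λ _ → inj₂
    ; W⊆root       = λ v∈W → v∈W
    ; covers-U     = λ v∈U → ⊥-elim (U≡∅ v∈U)
    ; covers-edges = λ u∈U _ → ⊥-elim (U≡∅ u∈U)
    ; narrow       = λ _ → ≤-trans ∣W∣≤L (≤-trans (m≤m+n L k) (n≤1+n (L + k)))
    }

  module MoveToRoot (U W : Subset (n G)) {u : V} (u∈U : u ∈ U) where

    U′? : Decidable λ v → v ∈ U × v ≢ u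
    U′? v = v ∈? U ×-dec ¬? (v ≟ᶠ u)

    W′? : Decidable λ v → v ∈ W ⊎ v ≡ u
    W′? v = v ∈? W ⊎-dec v ≟ᶠ u

    U′ W′ : Subset (n G)
    U′ = subset U′?
    W′ = subset W′?

    ∣U′∣<∣U∣ : ∣ U′ ∣ < ∣ U ∣
    ∣U′∣<∣U∣ = ≤-<-trans (p⊆q⇒∣p∣≤∣q∣ λ v∈U′ → let v∈U , v≢u = ∈-subset⁻ U′? v∈U′ in x∈p∧x≢y⇒x∈p-y v∈U v≢u)
                         (x∈p⇒∣p-x∣<∣p∣ u∈U)

    moved-frontier : Frontier U W → ∣ W ∣ < L → Frontier U′ W′
    moved-frontier fr ∣W∣<L = record { disjoint = disjoint′ ; neighbours⊆U∪W = neighbours′ ; small = small′ }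
      where
      open Frontier fr
      disjoint′ : DisjointFrom U′ W′
      disjoint′ v v∈U′ v∈W′ with ∈-subset⁻ U′? v∈U′ | ∈-subset⁻ W′? v∈W′
      ... | v∈U , _   | inj₁ v∈W = disjoint v v∈U v∈W
      ... | _   , v≢u | inj₂ v≡u = v≢u v≡u
      neighbours′ : ∀ {a v} → a ∈ U′ → adj G a v ≡ true → v ∈ U′ ⊎ v ∈ W′
      neighbours′ {v = v} a∈U′ e with neighbours⊆U∪W (proj₁ (∈-subset⁻ U′? a∈U′)) e | v ≟ᶠ u
      ... | inj₂ v∈W | _       = inj₂ (∈-subset⁺ W′? (inj₁ v∈W))
      ... | inj₁ _   | yes v≡u = inj₂ (∈-subset⁺ W′? (inj₂ v≡u))
      ... | inj₁ v∈U | no  v≢u = inj₁ (∈-subset⁺ U′? (v∈U , v≢u))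
      small′ : ∣ W′ ∣ ≤ L
      small′ = begin
        ∣ W′ ∣           ≤⟨ ∣r∣≤∣p∣+∣q∣ W ⁅ u ⁆ (W′⊆W∪⁅u⁆ ∘ ∈-subset⁻ W′?) ⟩
        ∣ W ∣ + ∣ ⁅ u ⁆ ∣ ≡⟨ cong (∣ W ∣ +_) (∣⁅x⁆∣≡1 u) ⟩
        ∣ W ∣ + 1        ≡⟨ +-comm ∣ W ∣ 1 ⟩
        suc ∣ W ∣       ≤⟨ ∣W∣<L ⟩
        L               ∎
        where
        open ≤-Reasoning
        W′⊆W∪⁅u⁆ : ∀ {v} → v ∈ W ⊎ v ≡ u → v ∈ W ⊎ v ∈ ⁅ u ⁆
        W′⊆W∪⁅u⁆ (inj₁ v∈W) = inj₁ v∈W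
        W′⊆W∪⁅u⁆ (inj₂ refl) = inj₂ (x∈⁅x⁆ u)

    from-moved : Frontier U W → PartialDecomposition U′ W′ → PartialDecomposition U W
    from-moved fr P = record
      { bagTree      = bagTree P
      ; bags⊆U∪W     = bags⊆U∪W′
      ; W⊆root       = λ v∈W → W⊆root P (∈-subset⁺ W′? (inj₁ v∈W))
      ; covers-U     = covers-U′
      ; covers-edges = covers-edges′
      ; narrow       = narrow P
      }
      where
      open Frontier fr
      u∈root : u ∈ bagOf (bagTree P) zero
      u∈root = W⊆root P (∈-subset⁺ W′? (inj₂ refl))

      bags⊆U∪W′ : ∀ x {v} → v ∈ bagOf (bagTree P) x → v ∈ U ⊎ v ∈ W
      bags⊆U∪W′ x v∈x with bags⊆U∪W P x v∈x
      ... | inj₁ v∈U′ = inj₁ (proj₁ (∈-subset⁻ U′? v∈U′))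
      ... | inj₂ v∈W′ with ∈-subset⁻ W′? v∈W′
      ...   | inj₁ v∈W  = inj₂ v∈W
      ...   | inj₂ refl = inj₁ u∈U

      covers-U′ : ∀ {v} → v ∈ U → ∃ λ x → v ∈ bagOf (bagTree P) x
      covers-U′ {v} v∈U with v ≟ᶠ u
      ... | yes refl = zero , u∈root
      ... | no  v≢u  = covers-U P (∈-subset⁺ U′? (v∈U , v≢u))

      covers-edges′ : ∀ {a v} → a ∈ U → adj G a v ≡ true →
                      ∃ λ x → a ∈ bagOf (bagTree P) x × v ∈ bagOf (bagTree P) x
      covers-edges′ {a} {v} a∈U e with a ≟ᶠ u
      ... | no a≢u = covers-edges P (∈-subset⁺ U′? (a∈U , a≢u)) e
      ... | yes refl with v ≟ᶠ u | neighbours⊆U∪W a∈U e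
      ...   | yes refl | _        = ⊥-elim (no-loop e)
      ...   | no  _    | inj₂ v∈W = zero , u∈root , W⊆root P (∈-subset⁺ W′? (inj₁ v∈W))
      ...   | no  v≢u  | inj₁ v∈U =
        let x , v∈x , u∈x = covers-edges P (∈-subset⁺ U′? (v∈U , v≢u)) (adj-sym e) in x , u∈x , v∈x

  module Split (U W : Subset (n G)) (fr : Frontier U W) (β : Breaking G k (suc k) W) where

    open Frontier fr
    open Breaking β

    open Closure (adj G) (λ v → ¬? (v ∈? S)) A (λ {a} → A∩S≡∅ a) using (closedHull)
    open Closure.ClosedHull closedHull renaming (hull to X)

    X∩B≡∅ : DisjointFrom X B
    X∩B≡∅ v v∈X v∈B = let a , a∈A , a⇝v = reachable v∈X in separated a v a∈A v∈B a⇝v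

    R? : Decidable λ v → v ∈ W ⊎ (v ∈ S × v ∈ U)
    R? v = v ∈? W ⊎-dec (v ∈? S ×-dec v ∈? U)

    R : Subset (n G)
    R = subset R?

    R⊆U∪W : ∀ {v} → v ∈ R → v ∈ U ⊎ v ∈ W
    R⊆U∪W v∈R with ∈-subset⁻ R? v∈R
    ... | inj₁ v∈W       = inj₂ v∈W
    ... | inj₂ (_ , v∈U) = inj₁ v∈U

    ∣R∣≤L+k : ∣ R ∣ ≤ L + k
    ∣R∣≤L+k = ≤-trans (∣r∣≤∣p∣+∣q∣ W S R⊆W∪S) (+-mono-≤ small ∣S∣≤k)
      where
      R⊆W∪S : ∀ {v} → v ∈ R → v ∈ W ⊎ v ∈ S
      R⊆W∪S v∈R with ∈-subset⁻ R? v∈R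
      ... | inj₁ v∈W       = inj₁ v∈W
      ... | inj₂ (v∈S , _) = inj₂ v∈S

    module Side (Y : Subset (n G)) (Y-closed : ∀ {u v} → u ∈ Y → u ∉ S → v ∉ S → adj G u v ≡ true → v ∈ Y)
                (Z : Subset (n G)) (Z⊆W : Z ⊆ W) (∣Z∣>k : ∣ Z ∣ ≥ suc k) (Z∩Y≡∅ : DisjointFrom Z Y) where

      Uʸ? : Decidable λ v → v ∈ U × v ∉ S × v ∈ Y
      Uʸ? v = v ∈? U ×-dec ¬? (v ∈? S) ×-dec v ∈? Y

      Wʸ? : Decidable λ v → (v ∈ W × v ∈ Y) ⊎ (v ∈ S × (v ∈ U ⊎ v ∈ W))
      Wʸ? v = (v ∈? W ×-dec v ∈? Y) ⊎-dec (v ∈? S ×-dec (v ∈? U ⊎-dec v ∈? W))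

      Uʸ Wʸ : Subset (n G)
      Uʸ = subset Uʸ?
      Wʸ = subset Wʸ?

      Uʸ⊆Y : ∀ {v} → v ∈ Uʸ → v ∈ Y
      Uʸ⊆Y v∈Uʸ = let _ , _ , v∈Y = ∈-subset⁻ Uʸ? v∈Uʸ in v∈Y

      ∣Uʸ∣≤∣U∣ : ∣ Uʸ ∣ ≤ ∣ U ∣
      ∣Uʸ∣≤∣U∣ = p⊆q⇒∣p∣≤∣q∣ (proj₁ ∘ ∈-subset⁻ Uʸ?)

      Uʸ∩R≡∅ : DisjointFrom Uʸ R
      Uʸ∩R≡∅ v v∈Uʸ v∈R with ∈-subset⁻ Uʸ? v∈Uʸ | ∈-subset⁻ R? v∈R
      ... | v∈U , _   , _ | inj₁ v∈W       = disjoint v v∈U v∈W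
      ... | _   , v∉S , _ | inj₂ (v∈S , _) = v∉S v∈S

      Wʸ⊆R : Wʸ ⊆ R
      Wʸ⊆R v∈Wʸ with ∈-subset⁻ Wʸ? v∈Wʸ
      ... | inj₁ (v∈W , _)        = ∈-subset⁺ R? (inj₁ v∈W)
      ... | inj₂ (v∈S , inj₁ v∈U) = ∈-subset⁺ R? (inj₂ (v∈S , v∈U))
      ... | inj₂ (_   , inj₂ v∈W) = ∈-subset⁺ R? (inj₁ v∈W)

      Uʸ∪Wʸ⊆U∪W : ∀ {v} → v ∈ Uʸ ⊎ v ∈ Wʸ → v ∈ U ⊎ v ∈ W
      Uʸ∪Wʸ⊆U∪W (inj₁ v∈Uʸ) = inj₁ (proj₁ (∈-subset⁻ Uʸ? v∈Uʸ))
      Uʸ∪Wʸ⊆U∪W (inj₂ v∈Wʸ) = R⊆U∪W (Wʸ⊆R v∈Wʸ)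

      ∣Wʸ∣<L : ∣ Wʸ ∣ < L
      ∣Wʸ∣<L = begin-strict
        ∣ Wʸ ∣             ≤⟨ ∣r∣≤∣p∣+∣q∣ (W ∩ Y) S Wʸ⊆W∩Y∪S ⟩
        ∣ W ∩ Y ∣ + ∣ S ∣   <⟨ +-monoʳ-< ∣ W ∩ Y ∣ (s≤s ∣S∣≤k) ⟩
        ∣ W ∩ Y ∣ + suc k   ≤⟨ +-monoʳ-≤ ∣ W ∩ Y ∣ ∣Z∣>k ⟩
        ∣ W ∩ Y ∣ + ∣ Z ∣   ≤⟨ ∣p∣+∣q∣≤∣r∣ (W ∩ Y) Z W (p∩q⊆p W Y) Z⊆W W∩Y∩Z≡∅ ⟩
        ∣ W ∣              ≤⟨ small ⟩
        L                  ∎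
        where
        open ≤-Reasoning
        Wʸ⊆W∩Y∪S : ∀ {v} → v ∈ Wʸ → v ∈ W ∩ Y ⊎ v ∈ S
        Wʸ⊆W∩Y∪S v∈Wʸ with ∈-subset⁻ Wʸ? v∈Wʸ
        ... | inj₁ v∈W×Y     = inj₁ (x∈p∩q⁺ v∈W×Y)
        ... | inj₂ (v∈S , _) = inj₂ v∈S
        W∩Y∩Z≡∅ : DisjointFrom (W ∩ Y) Z
        W∩Y∩Z≡∅ v v∈W∩Y v∈Z = Z∩Y≡∅ v v∈Z (proj₂ (x∈p∩q⁻ W Y v∈W∩Y))

      frontier : Frontier Uʸ Wʸ
      frontier = record { disjoint = disjoint′ ; neighbours⊆U∪W = neighbours′ ; small = <⇒≤ ∣Wʸ∣<L }
        where
        disjoint′ : DisjointFrom Uʸ Wʸ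
        disjoint′ v v∈Uʸ v∈Wʸ = Uʸ∩R≡∅ v v∈Uʸ (Wʸ⊆R v∈Wʸ)
        neighbours′ : ∀ {a v} → a ∈ Uʸ → adj G a v ≡ true → v ∈ Uʸ ⊎ v ∈ Wʸ
        neighbours′ {a} {v} a∈Uʸ e with ∈-subset⁻ Uʸ? a∈Uʸ
        ... | a∈U , a∉S , a∈Y with v ∈? S | neighbours⊆U∪W a∈U e
        ...   | yes v∈S | v∈U∪W    = inj₂ (∈-subset⁺ Wʸ? (inj₂ (v∈S , v∈U∪W)))
        ...   | no  v∉S | inj₁ v∈U = inj₁ (∈-subset⁺ Uʸ? (v∈U , v∉S , Y-closed a∈Y a∉S v∉S e))
        ...   | no  v∉S | inj₂ v∈W = inj₂ (∈-subset⁺ Wʸ? (inj₁ (v∈W , Y-closed a∈Y a∉S v∉S e)))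

    module SideA = Side X (λ u∈X _ v∉S e → closed u∈X v∉S e)
                        B B⊆W ∣B∣≥m (λ v v∈B v∈X → X∩B≡∅ v v∈X v∈B)
    module SideB = Side (∁ X) (λ u∈∁X u∉S v∉S e → x∉p⇒x∈∁p λ v∈X → x∈∁p⇒x∉p u∈∁X (closed v∈X u∉S (adj-sym e)))
                        A A⊆W ∣A∣≥m (λ v v∈A v∈∁X → x∈∁p⇒x∉p v∈∁X (⊇A v∈A))

    side : ∀ {v} → v ∈ U → v ∉ S → v ∈ SideA.Uʸ ⊎ v ∈ SideB.Uʸ
    side {v} v∈U v∉S with v ∈? X
    ... | yes v∈X = inj₁ (∈-subset⁺ SideA.Uʸ? (v∈U , v∉S , v∈X))
    ... | no  v∉X = inj₂ (∈-subset⁺ SideB.Uʸ? (v∈U , v∉S , x∉p⇒x∈∁p v∉X))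

    module Combine (Pa : PartialDecomposition SideA.Uʸ SideA.Wʸ) (Pb : PartialDecomposition SideB.Uʸ SideB.Wʸ) where

      module D₁ = GraftBags (singletonBagTree R) zero (bagTree Pa)

      glue₁ : D₁.Glue
      glue₁ v _ y v∈R v∈y with bags⊆U∪W Pa y v∈y
      ... | inj₁ v∈Ua = ⊥-elim (SideA.Uʸ∩R≡∅ v v∈Ua v∈R)
      ... | inj₂ v∈Wa = v∈R , W⊆root Pa v∈Wa

      module D₂ = GraftBags (D₁.graft glue₁) zero (bagTree Pb)

      Ub∉D₁ : ∀ {v} → v ∈ SideB.Uʸ → ∀ x → v ∉ D₁.bags x
      Ub∉D₁ {v} v∈Ub = D₁.all-bags (v ∉_) (λ _ → SideB.Uʸ∩R≡∅ v v∈Ub) λ y v∈y → Ub∉Pa (bags⊆U∪W Pa y v∈y)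
        where
        Ub∉Pa : v ∈ SideA.Uʸ ⊎ v ∈ SideA.Wʸ → ⊥
        Ub∉Pa (inj₁ v∈Ua) = x∈∁p⇒x∉p (SideB.Uʸ⊆Y v∈Ub) (SideA.Uʸ⊆Y v∈Ua)
        Ub∉Pa (inj₂ v∈Wa) = SideB.Uʸ∩R≡∅ v v∈Ub (SideA.Wʸ⊆R v∈Wa)

      glue₂ : D₂.Glue
      glue₂ v x y v∈x v∈y with bags⊆U∪W Pb y v∈y
      ... | inj₁ v∈Ub = ⊥-elim (Ub∉D₁ v∈Ub x v∈x)
      ... | inj₂ v∈Wb = SideB.Wʸ⊆R v∈Wb , W⊆root Pb v∈Wb

      D : BagTree (n G)
      D = D₂.graft glue₂

      liftA : (Q : Subset (n G) → Set) → (∃ λ y → Q (bagOf (bagTree Pa) y)) → ∃ λ x → Q (bagOf D x)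
      liftA Q (y , q) = D₂.left (D₁.right y) , subst Q (≡.sym (trans (D₂.bags-left (D₁.right y)) (D₁.bags-right y))) q

      liftB : (Q : Subset (n G) → Set) → (∃ λ y → Q (bagOf (bagTree Pb) y)) → ∃ λ x → Q (bagOf D x)
      liftB Q (y , q) = D₂.right y , subst Q (≡.sym (D₂.bags-right y)) q

      Within-U∪W : Subset (n G) → Set
      Within-U∪W b = ∀ {v} → v ∈ b → v ∈ U ⊎ v ∈ W

      bags⊆U∪W′ : ∀ x → Within-U∪W (bagOf D x)
      bags⊆U∪W′ = D₂.all-bags Within-U∪W
                    (D₁.all-bags Within-U∪W (λ _ → R⊆U∪W) λ y → SideA.Uʸ∪Wʸ⊆U∪W ∘ bags⊆U∪W Pa y)
                    (λ y → SideB.Uʸ∪Wʸ⊆U∪W ∘ bags⊆U∪W Pb y)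

      narrow′ : ∀ x → ∣ bagOf D x ∣ ≤ suc (L + k)
      narrow′ = D₂.all-bags (λ b → ∣ b ∣ ≤ suc (L + k))
                  (D₁.all-bags (λ b → ∣ b ∣ ≤ suc (L + k)) (λ _ → ≤-trans ∣R∣≤L+k (n≤1+n (L + k))) (narrow Pa))
                  (narrow Pb)

      covers-U′ : ∀ {v} → v ∈ U → ∃ λ x → v ∈ bagOf D x
      covers-U′ {v} v∈U with v ∈? S
      ... | yes v∈S = zero , ∈-subset⁺ R? (inj₂ (v∈S , v∈U))
      ... | no  v∉S with side v∈U v∉S
      ...   | inj₁ v∈Ua = liftA (v ∈_) (covers-U Pa v∈Ua)
      ...   | inj₂ v∈Ub = liftB (v ∈_) (covers-U Pb v∈Ub)

      edge-off-S : ∀ {a v} → a ∈ U → a ∉ S → adj G a v ≡ true → ∃ λ x → a ∈ bagOf D x × v ∈ bagOf D x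
      edge-off-S {a} {v} a∈U a∉S e with side a∈U a∉S
      ... | inj₁ a∈Ua = liftA (λ b → a ∈ b × v ∈ b) (covers-edges Pa a∈Ua e)
      ... | inj₂ a∈Ub = liftB (λ b → a ∈ b × v ∈ b) (covers-edges Pb a∈Ub e)

      covers-edges′ : ∀ {a v} → a ∈ U → adj G a v ≡ true → ∃ λ x → a ∈ bagOf D x × v ∈ bagOf D x
      covers-edges′ {a} {v} a∈U e with a ∈? S
      ... | no  a∉S = edge-off-S a∈U a∉S e
      ... | yes a∈S with neighbours⊆U∪W a∈U e
      ...   | inj₂ v∈W = zero , ∈-subset⁺ R? (inj₂ (a∈S , a∈U)) , ∈-subset⁺ R? (inj₁ v∈W)
      ...   | inj₁ v∈U with v ∈? S
      ...     | yes v∈S = zero , ∈-subset⁺ R? (inj₂ (a∈S , a∈U)) , ∈-subset⁺ R? (inj₂ (v∈S , v∈U))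
      ...     | no  v∉S = let x , v∈x , a∈x = edge-off-S v∈U v∉S (adj-sym e) in x , a∈x , v∈x

      combined : PartialDecomposition U W
      combined = record
        { bagTree      = D
        ; bags⊆U∪W     = bags⊆U∪W′
        ; W⊆root       = ∈-subset⁺ R? ∘ inj₁
        ; covers-U     = covers-U′
        ; covers-edges = covers-edges′
        ; narrow       = narrow′
        }

  -- f bounds ∣ U ∣: splitting does not shrink U, but each side then starts by moving a vertex to the root
  mutual
    decompose : ∀ f U W → ∣ U ∣ ≤ f → Frontier U W → PartialDecomposition U W
    decompose f U W ∣U∣≤f fr with ∣ W ∣ <? L
    ... | yes ∣W∣<L = decompose-small f U W ∣U∣≤f fr ∣W∣<L
    ... | no  ∣W∣≮L = Combine.combined (decompose-small f SideA.Uʸ SideA.Wʸ (≤-trans SideA.∣Uʸ∣≤∣U∣ ∣U∣≤f) SideA.frontier SideA.∣Wʸ∣<L)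
                              (decompose-small f SideB.Uʸ SideB.Wʸ (≤-trans SideB.∣Uʸ∣≤∣U∣ ∣U∣≤f) SideB.frontier SideB.∣Wʸ∣<L)
      where open Split U W fr (breaking (breaks W (≮⇒≥ ∣W∣≮L)))

    decompose-small : ∀ f U W → ∣ U ∣ ≤ f → Frontier U W → ∣ W ∣ < L → PartialDecomposition U W
    decompose-small f U W ∣U∣≤f fr ∣W∣<L with nonempty? U
    ... | no  U≡∅ = single-bag (λ v∈U → U≡∅ (_ , v∈U)) (<⇒≤ ∣W∣<L)
    decompose-small zero    U W ∣U∣≤f fr ∣W∣<L | yes (u , u∈U) = ⊥-elim (<⇒≱ (MoveToRoot.∣U′∣<∣U∣ U W u∈U) (≤-trans ∣U∣≤f z≤n))
    decompose-small (suc f) U W ∣U∣≤f fr ∣W∣<L | yes (u , u∈U) =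
      from-moved fr (decompose f U′ W′ (≤-pred (≤-trans ∣U′∣<∣U∣ ∣U∣≤f)) (moved-frontier fr ∣W∣<L))
      where open MoveToRoot U W u∈U

  treewidth≤ : TreewidthAtMost G (L + k)
  treewidth≤ =
    record { tree                 = shape (bagTree P)
           ; bag                  = bagOf (bagTree P)
           ; covers-vertices      = λ v → covers-U P ∈⊤
           ; covers-edges         = λ u v → covers-edges P ∈⊤
           ; connected-occurrence = occurrences-connected (bagTree P) } ,
    narrow P
    where
    initial : Frontier full ∅
    initial = record { disjoint = λ _ _ → ∉⊥ ; neighbours⊆U∪W = λ _ _ → inj₁ ∈⊤
                     ; small = ≤-trans (≤-reflexive (∣⊥∣≡0 (n G))) z≤n }
    P : PartialDecomposition full ∅
    P = decompose (n G) full ∅ (∣p∣≤n full) initial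

breakable⇒bounded-treewidth : ∀ C → DistInfDeletionBreakable C → BoundedTreewidth C
breakable⇒bounded-treewidth C (N , k , breaks) =
  N (suc k) + k , λ G G∈C → FromBreakability.treewidth≤ G (N (suc k)) k (breaks (suc k) G G∈C)

-- room for the separating bag (k + 1 vertices), A (fewer than 2m + k + 1) and m vertices of B
breaking-size : ℕ → ℕ → ℕ
breaking-size k m = suc k + (m + (m + suc k) + m)

module FromTreeDecomposition (G : Graph) (D : TreeDecomposition G) (k : ℕ) (narrow : HasWidthAtMost D k)
                             (m : ℕ) (W : Subset (n G)) (∣W∣≥N : ∣ W ∣ ≥ breaking-size k m) where

  private
    T = tree D
    V = Fin (n G)
    heavy = m + suc k

  0<heavy : 0 < heavy
  0<heavy = ≤-trans (s≤s z≤n) (m≤n+m (suc k) m)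

  OccursBelow : Node T → V → Set
  OccursBelow c v = ∃ λ y → Descendant T c y × v ∈ bag D y

  occursBelow? : ∀ c → Decidable (OccursBelow c)
  occursBelow? c v = any? λ y → descendant? T c y ×-dec v ∈? bag D y

  W-below? : ∀ c → Decidable λ v → v ∈ W × OccursBelow c v
  W-below? c v = v ∈? W ×-dec occursBelow? c v

  W-below : Node T → Subset (n G)
  W-below c = subset (W-below? c)

  Heavy : Node T → Set
  Heavy c = heavy ≤ ∣ W-below c ∣

  root-heavy : Heavy zero
  root-heavy = begin
    heavy                 ≤⟨ ≤-trans (m≤n+m heavy m) (≤-trans (m≤m+n (m + heavy) m) (m≤n+m _ (suc k))) ⟩
    breaking-size k m     ≤⟨ ∣W∣≥N ⟩
    ∣ W ∣                 ≤⟨ p⊆q⇒∣p∣≤∣q∣ (λ {v} v∈W → ∈-subset⁺ (W-below? zero) (v∈W , occurs v)) ⟩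
    ∣ W-below zero ∣      ∎
    where
    open ≤-Reasoning
    occurs : ∀ v → OccursBelow zero v
    occurs v = let y , v∈y = covers-vertices D v in y , root-ancestor T y , v∈y

  module AtLowestHeavy (x : Node T) (x-heavy : Heavy x) (children-light : ∀ {c} → IsChild T c x → ¬ Heavy c) where

    EarlyChildBelow : ℕ → V → Set
    EarlyChildBelow j v = ∃ λ c → toℕ c < j × IsChild T c x × OccursBelow c v

    earlyChildBelow? : ∀ j → Decidable (EarlyChildBelow j)
    earlyChildBelow? j v = any? λ c → toℕ c <? j ×-dec isChild? T c x ×-dec occursBelow? c v

    Early? : ∀ j → Decidable λ v → v ∈ W × v ∉ bag D x × EarlyChildBelow j v
    Early? j v = v ∈? W ×-dec ¬? (v ∈? bag D x) ×-dec earlyChildBelow? j v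

    Early : ℕ → Subset (n G)
    Early j = subset (Early? j)

    ∣Early0∣≡0 : ∣ Early 0 ∣ ≡ 0
    ∣Early0∣≡0 = trans (cong ∣_∣ (Empty-unique λ (_ , v∈) → never (∈-subset⁻ (Early? 0) v∈))) (∣⊥∣≡0 (n G))
      where
      never : ∀ {v} → ¬ (v ∈ W × v ∉ bag D x × EarlyChildBelow 0 v)
      never (_ , _ , _ , () , _)

    Early-suc : ∀ {j v} → v ∈ Early (suc j) →
                v ∈ Early j ⊎ (v ∈ W × ∃ λ c → toℕ c ≡ j × IsChild T c x × OccursBelow c v)
    Early-suc {j} v∈ with ∈-subset⁻ (Early? (suc j)) v∈
    ... | v∈W , v∉x , c , c≤j , c◁x , below-c with m≤n⇒m<n∨m≡n (≤-pred c≤j)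
    ...   | inj₁ c<j = inj₁ (∈-subset⁺ (Early? j) (v∈W , v∉x , c , c<j , c◁x , below-c))
    ...   | inj₂ c≡j = inj₂ (v∈W , c , c≡j , c◁x , below-c)

    early-step : ∀ j → ∣ Early (suc j) ∣ < ∣ Early j ∣ + heavy
    early-step j with any? (λ c → toℕ c ≟ j ×-dec isChild? T c x)
    ... | yes (c , c≡j , c◁x) = begin-strict
      ∣ Early (suc j) ∣            ≤⟨ ∣r∣≤∣p∣+∣q∣ (Early j) (W-below c) split ⟩
      ∣ Early j ∣ + ∣ W-below c ∣  <⟨ +-monoʳ-< ∣ Early j ∣ (≰⇒> (children-light c◁x)) ⟩
      ∣ Early j ∣ + heavy          ∎
      where
      open ≤-Reasoning
      split : ∀ {v} → v ∈ Early (suc j) → v ∈ Early j ⊎ v ∈ W-below c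
      split {v} v∈ with Early-suc v∈
      ... | inj₁ v∈Early = inj₁ v∈Early
      ... | inj₂ (v∈W , c′ , c′≡j , _ , below-c′) =
        inj₂ (∈-subset⁺ (W-below? c) (v∈W , subst (λ c → OccursBelow c v) (toℕ-injective (trans c′≡j (≡.sym c≡j))) below-c′))
    ... | no no-jth-child = ≤-<-trans (p⊆q⇒∣p∣≤∣q∣ shrink) (m<m+n ∣ Early j ∣ 0<heavy)
      where
      shrink : ∀ {v} → v ∈ Early (suc j) → v ∈ Early j
      shrink v∈ with Early-suc v∈
      ... | inj₁ v∈Early                      = v∈Early
      ... | inj₂ (_ , c′ , c′≡j , c′◁x , _) = ⊥-elim (no-jth-child (c′ , c′≡j , c′◁x))

    m≤∣Early-all∣ : m ≤ ∣ Early (suc (t T)) ∣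
    m≤∣Early-all∣ = +-cancelˡ-≤ (suc k) m _ (begin
      suc k + m                       ≡⟨ +-comm (suc k) m ⟩
      heavy                           ≤⟨ x-heavy ⟩
      ∣ W-below x ∣                   ≤⟨ ∣r∣≤∣p∣+∣q∣ (bag D x) (Early (suc (t T))) split ⟩
      ∣ bag D x ∣ + ∣ Early (suc (t T)) ∣ ≤⟨ +-monoˡ-≤ _ (narrow x) ⟩
      suc k + ∣ Early (suc (t T)) ∣   ∎)
      where
      open ≤-Reasoning
      split : ∀ {v} → v ∈ W-below x → v ∈ bag D x ⊎ v ∈ Early (suc (t T))
      split {v} v∈ with v ∈? bag D x | ∈-subset⁻ (W-below? x) v∈
      ... | yes v∈x | _ = inj₁ v∈x
      ... | no  v∉x | v∈W , y , x≼y , v∈y with y ≟ᶠ x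
      ...   | yes refl = ⊥-elim (v∉x v∈y)
      ...   | no  y≢x  = let c , c◁x , c≼y = descends-via-child T x≼y y≢x in
                         inj₂ (∈-subset⁺ (Early? _) (v∈W , v∉x , c , toℕ<n c , c◁x , y , c≼y , v∈y))

    early-closed : ∀ {j u v} → u ∉ bag D x → adj G u v ≡ true → EarlyChildBelow j u → EarlyChildBelow j v
    early-closed {u = u} {v} u∉x e (c , c<j , c◁x , y , c≼y , u∈y) with covers-edges D u v e
    ... | y′ , u∈y′ , v∈y′ with descendant? T c y′
    ...   | yes c≼y′ = c , c<j , c◁x , y′ , c≼y′ , v∈y′
    ...   | no  c⋠y′ = ⊥-elim (u∉x (exit-through-parent T c◁x (connected-occurrence D u y y′ u∈y u∈y′) c≼y c⋠y′))

    early-reach : ∀ {j u v} → SameComponentIn-G-minus G (bag D x) u v → EarlyChildBelow j u → EarlyChildBelow j v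
    early-reach (here _)          early = early
    early-reach (step u∉x e walk) early = early-reach walk (early-closed u∉x e early)

    private
      cut : ∃ λ j → m ≤ ∣ Early j ∣ × ∣ Early j ∣ < m + heavy
      cut = enters-window (λ j → ∣ Early j ∣) (subst (_< m + heavy) (≡.sym ∣Early0∣≡0) (<-≤-trans 0<heavy (m≤n+m heavy m)))
                          early-step (suc (t T)) m≤∣Early-all∣
      j = proj₁ cut

    A : Subset (n G)
    A = Early j

    Late? : Decidable λ v → v ∈ W × v ∉ bag D x × ¬ EarlyChildBelow j v
    Late? v = v ∈? W ×-dec ¬? (v ∈? bag D x) ×-dec ¬? (earlyChildBelow? j v)

    B : Subset (n G)
    B = subset Late?

    m≤∣B∣ : m ≤ ∣ B ∣
    m≤∣B∣ = +-cancelˡ-≤ (m + heavy) m ∣ B ∣ (+-cancelˡ-≤ (suc k) _ _ (begin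
      breaking-size k m                  ≤⟨ ∣W∣≥N ⟩
      ∣ W ∣                              ≤⟨ ∣r∣≤∣p∣+∣q∣ (bag D x) (A ∪ B) split ⟩
      ∣ bag D x ∣ + ∣ A ∪ B ∣            ≤⟨ +-mono-≤ (narrow x) (∣p∪q∣≤∣p∣+∣q∣ A B) ⟩
      suc k + (∣ A ∣ + ∣ B ∣)            ≤⟨ +-monoʳ-≤ (suc k) (+-monoˡ-≤ ∣ B ∣ (<⇒≤ (proj₂ (proj₂ cut)))) ⟩
      suc k + (m + heavy + ∣ B ∣)        ∎))
      where
      open ≤-Reasoning
      split : ∀ {v} → v ∈ W → v ∈ bag D x ⊎ v ∈ A ∪ B
      split {v} v∈W with v ∈? bag D x | earlyChildBelow? j v
      ... | yes v∈x | _             = inj₁ v∈x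
      ... | no  v∉x | yes early     = inj₂ (x∈p∪q⁺ (inj₁ (∈-subset⁺ (Early? j) (v∈W , v∉x , early))))
      ... | no  v∉x | no  not-early = inj₂ (x∈p∪q⁺ (inj₂ (∈-subset⁺ Late? (v∈W , v∉x , not-early))))

    A-B-separated : ∀ a b → a ∈ A → b ∈ B → ¬ SameComponentIn-G-minus G (bag D x) a b
    A-B-separated a b a∈A b∈B a⇝b =
      let _ , _ , a-early = ∈-subset⁻ (Early? j) a∈A
          _ , _ , b-late  = ∈-subset⁻ Late? b∈B
      in b-late (early-reach a⇝b a-early)

    breaks : Breaks G (suc k) m W
    breaks = bag D x , A , B , narrow x ,
             proj₁ ∘ ∈-subset⁻ (Early? j) , (λ _ → proj₁ ∘ proj₂ ∘ ∈-subset⁻ (Early? j)) ,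
             proj₁ ∘ ∈-subset⁻ Late? , (λ _ → proj₁ ∘ proj₂ ∘ ∈-subset⁻ Late?) ,
             proj₁ (proj₂ cut) , m≤∣B∣ , A-B-separated

  heavy? : Decidable Heavy
  heavy? c = heavy ≤? ∣ W-below c ∣

  breaks : Breaks G (suc k) m W
  breaks = let x , x-heavy , lighter-after-x = greatest heavy? root-heavy in
           AtLowestHeavy.breaks x x-heavy (λ c◁x → lighter-after-x _ (child-index T c◁x))

bounded-treewidth⇒breakable : ∀ C → BoundedTreewidth C → DistInfDeletionBreakable C
bounded-treewidth⇒breakable C (k , tw≤k) =
  breaking-size k , suc k , λ m G G∈C W ∣W∣≥N →
    let D , narrow = tw≤k G G∈C in FromTreeDecomposition.breaks G D k narrow m W ∣W∣≥N

theorem18p12 : (C : GraphClass) → BoundedTreewidth C ⇔ DistInfDeletionBreakable C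
theorem18p12 C = mk⇔ (bounded-treewidth⇒breakable C) (breakable⇒bounded-treewidth C)
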